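{- Let $b\ge2$ be an integer and let $n,m$ be positive integers such that the base-$b$ addition $n+m$ is carry-free (i.e. $n_l+m_l\le b-1$ for every digit position $l$). Then for every integer $k\ge m$, \[\binom{ -n-m}{k}_b=\sum_{j=0}^{k}\binom{ -n}{k-j}_b\binom{ -m}{j}_b,\] and for every integer $k\ge n+m$, \[\binom{ -n-m}{ -k}_b=\sum_{j=1}^{k-1}\binom{ -n}{ -k+j}_b\binom{ -m}{ -j}_b.\]
   Context: Fix an integer base $b\ge2$. Every integer $r\ge0$ has base-$b$ digits $r_l\in\{0,\dots,b-1\}$ with $r=\sum_{l\ge0}r_lb^l$. By convention, for $r>0$ the digits of $-r$ are $-r_l$. For $r\in\mathbb Z$ with digits $r_l$, put $f_{r,b}(x)=\prod_{l\ge0}(1+x^{b^l})^{r_l}$. The $b$-ary binomial coefficient $\binom{r}{k}_b$ ($r,k\in\mathbb Z$) is defined as: if $r\ge0$, the coefficient of $x^k$ in the polynomial $f_{r,b}(x)$ (zero for $k<0$); if $r<0$ and $k\ge0$, the coefficient of $x^k$ in the power series expansion of $f_{r,b}(x)$ about $x=0$; if $r<0$ and $k<0$, the coefficient of $x^k$ in the expansion of $f_{r,b}(x)$ as a power series in $1/x$. -}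

module Defs where

open import Data.Nat as ℕ using (ℕ; zero; suc; NonZero; _≡ᵇ_; _≤ᵇ_)
open import Data.Nat.DivMod using (_/_; _%_)
open import Data.Nat.Properties using (m^n≢0)
open import Data.Integer as ℤ using (ℤ; +_; -[1+_])
open import Data.Bool using (if_then_else_)

-- Formal power series (in a single variable) with integer coefficients,
-- represented by their coefficient function.
Ser : Set
Ser = ℕ → ℤ

Σ< : ℕ → (ℕ → ℤ) → ℤ
Σ< zero    f = + 0
Σ< (suc n) f = Σ< n f ℤ.+ f n

-- Σ_{j=a}^{c} f j  (empty if c < a)
Σ[_to_] : ℕ → ℕ → (ℕ → ℤ) → ℤ
Σ[ a to c ] f = Σ< (suc c ℕ.∸ a) (λ i → f (a ℕ.+ i))

_⊛_ : Ser → Ser → Ser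
(f ⊛ g) k = Σ< (suc k) (λ j → f j ℤ.* g (k ℕ.∸ j))

𝟙 : Ser
𝟙 k = if k ≡ᵇ 0 then + 1 else + 0

pow : Ser → ℕ → Ser
pow s zero    = 𝟙
pow s (suc d) = s ⊛ pow s d

onePlusY : Ser
onePlusY k = if k ≤ᵇ 1 then + 1 else + 0

-- (1 + y)^{-1} = Σ (-1)^i y^i
invOnePlusY : Ser
invOnePlusY k = if (k % 2) ≡ᵇ 0 then + 1 else ℤ.- (+ 1)

-- substitution y := y^B  (B ≠ 0)
substPow : (B : ℕ) .{{_ : NonZero B}} → Ser → Ser
substPow B s k = if (k % B) ≡ᵇ 0 then s (k / B) else + 0

-- multiplication by y^S
shift : ℕ → Ser → Ser
shift S s k = if S ≤ᵇ k then s (k ℕ.∸ S) else + 0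

digit : (b : ℕ) .{{_ : NonZero b}} → ℕ → ℕ → ℕ
digit b l r = (_/_ r (b ℕ.^ l) {{m^n≢0 b l}}) % b

Π< : ℕ → (ℕ → Ser) → Ser
Π< zero    F = 𝟙
Π< (suc L) F = Π< L F ⊛ F L

-- Digits r_l of r ≥ 0 vanish for l ≥ r (since b^l > l), so the infinite
-- product f_{r,b} equals the finite product over l < r + 1.

-- power series in x of f_{s,b}(x) = ∏ (1 + x^{b^l})^{s_l},  s ≥ 0
fPos : (b : ℕ) .{{_ : NonZero b}} → ℕ → Ser
fPos b s = Π< (suc s) (λ l →
  substPow (b ℕ.^ l) {{m^n≢0 b l}} (pow onePlusY (digit b l s)))

-- expansion about x = 0 of f_{-s,b}(x) = ∏ (1 + x^{b^l})^{-s_l},  s > 0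
fNegX : (b : ℕ) .{{_ : NonZero b}} → ℕ → Ser
fNegX b s = Π< (suc s) (λ l →
  substPow (b ℕ.^ l) {{m^n≢0 b l}} (pow invOnePlusY (digit b l s)))

-- expansion of f_{-s,b}(x) as a power series in y = 1/x:
-- (1 + x^B)^{-d} = y^{dB} (1 + y^B)^{-d}
fNegY : (b : ℕ) .{{_ : NonZero b}} → ℕ → Ser
fNegY b s = Π< (suc s) (λ l →
  shift (digit b l s ℕ.* b ℕ.^ l)
    (substPow (b ℕ.^ l) {{m^n≢0 b l}} (pow invOnePlusY (digit b l s))))

binom : (b : ℕ) .{{_ : NonZero b}} → ℤ → ℤ → ℤ
binom b (+ s)      (+ k)      = fPos b s k
binom b (+ s)      -[1+ k ]   = + 0
binom b -[1+ s' ]  (+ k)      = fNegX b (suc s') k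
binom b -[1+ s' ]  -[1+ k' ]  = fNegY b (suc s') (suc k')

module Submission where

-- Both identities are Cauchy-product identities of power series.  Write
-- F_{-r} for the expansion of f_{-r,b} (in x, resp. in y = 1/x); it is the
-- "digit product"  ∏_{l ≤ r} Φ(r_l, l)  of a factor family Φ(d, l) which is
-- multiplicative in the digit:  Φ(d + e, l) = Φ(d, l) Φ(e, l),  Φ(0, l) = 1.
-- For the x-expansion  Φ(d, l) = (1 + x^{b^l})^{-d};  for the y-expansion
-- Φ(d, l) = y^{d b^l} (1 + y^{b^l})^{-d}.  If n + m is carry-free, the digits
-- of n + m are the sums of the digits of n and m, hence
-- F_{-(n+m)} = F_{-n} F_{-m}, and comparing coefficients of x^k gives the
-- first identity.  For the second, the y-series of F_{-r} has zero constant
-- term when r ≥ 1 (some digit is nonzero, and that factor is divisible by y),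
-- so the terms j = 0 and j = k of the convolution vanish.

open import Defs
open import Data.Nat as ℕ using (ℕ; zero; suc; NonZero; _≤_; _<_; z≤n; s≤s; _∸_)
import Data.Nat.Properties as ℕP
open import Data.Nat.DivMod
open import Data.Integer as ℤ using (ℤ; +_; -[1+_]; _+_; _*_)
import Data.Integer.Properties as ℤP
open import Data.Integer.Tactic.RingSolver using (solve-∀)
open import Data.Fin using (toℕ; fromℕ<)
open import Data.Fin.Properties using (¬∀⟶∃¬; toℕ<n; toℕ-fromℕ<)
open import Data.Product using (_×_; _,_; ∃-syntax)
open import Data.Sum using (inj₁; inj₂)
open import Data.Bool using (true; false)
open import Function using (_∘_)
open import Relation.Nullary using (yes; no; ¬_; contradiction)
open import Relation.Binary.PropositionalEquality

open ≡-Reasoning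

infixr 4 _⟫_
_⟫_ : {f g h : Ser} → f ≗ g → g ≗ h → f ≗ h
(p ⟫ q) k = trans (p k) (q k)

≗-sym : {f g : Ser} → f ≗ g → g ≗ f
≗-sym p k = sym (p k)

Σ<-cong : ∀ n {F G : ℕ → ℤ} → (∀ i → i < n → F i ≡ G i) → Σ< n F ≡ Σ< n G
Σ<-cong zero    eq = refl
Σ<-cong (suc n) eq =
  cong₂ _+_ (Σ<-cong n (λ i i<n → eq i (ℕP.m<n⇒m<1+n i<n))) (eq n ℕP.≤-refl)

Σ<-zero : ∀ n {F : ℕ → ℤ} → (∀ i → i < n → F i ≡ + 0) → Σ< n F ≡ + 0
Σ<-zero zero    eq = refl
Σ<-zero (suc n) eq =
  cong₂ _+_ (Σ<-zero n (λ i i<n → eq i (ℕP.m<n⇒m<1+n i<n))) (eq n ℕP.≤-refl)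

Σ<-front : ∀ n (F : ℕ → ℤ) → Σ< (suc n) F ≡ F 0 + Σ< n (F ∘ suc)
Σ<-front zero    F = trans (ℤP.+-identityˡ (F 0)) (sym (ℤP.+-identityʳ (F 0)))
Σ<-front (suc n) F = begin
  Σ< (suc n) F + F (suc n)          ≡⟨ cong (_+ F (suc n)) (Σ<-front n F) ⟩
  F 0 + Σ< n (F ∘ suc) + F (suc n)  ≡⟨ ℤP.+-assoc (F 0) _ _ ⟩
  F 0 + Σ< (suc n) (F ∘ suc)        ∎

Σ<-split : ∀ a c (F : ℕ → ℤ) → Σ< (a ℕ.+ c) F ≡ Σ< a F + Σ< c (λ i → F (a ℕ.+ i))
Σ<-split a zero    F rewrite ℕP.+-identityʳ a = sym (ℤP.+-identityʳ _)
Σ<-split a (suc c) F rewrite ℕP.+-suc a c = begin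
  Σ< (a ℕ.+ c) F + F (a ℕ.+ c)                     ≡⟨ cong (_+ F (a ℕ.+ c)) (Σ<-split a c F) ⟩
  Σ< a F + Σ< c (λ i → F (a ℕ.+ i)) + F (a ℕ.+ c)  ≡⟨ ℤP.+-assoc (Σ< a F) _ _ ⟩
  Σ< a F + Σ< (suc c) (λ i → F (a ℕ.+ i))          ∎

Σ<-linear : ∀ n c (F G : ℕ → ℤ) →
  Σ< n (λ i → c * F i + G i) ≡ c * Σ< n F + Σ< n G
Σ<-linear zero    c F G = cong (_+ + 0) (sym (ℤP.*-zeroʳ c))
Σ<-linear (suc n) c F G = begin
  Σ< n (λ i → c * F i + G i) + (c * F n + G n)  ≡⟨ cong (_+ (c * F n + G n)) (Σ<-linear n c F G) ⟩
  c * Σ< n F + Σ< n G + (c * F n + G n)         ≡⟨ regroup c (Σ< n F) (Σ< n G) (F n) (G n) ⟩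
  c * Σ< (suc n) F + Σ< (suc n) G               ∎
  where
  regroup : ∀ c A B x y → c * A + B + (c * x + y) ≡ c * (A + x) + (B + y)
  regroup = solve-∀

Σ<-drop-ends : ∀ k (F : ℕ → ℤ) → F 0 ≡ + 0 → F (suc (suc k)) ≡ + 0 →
  Σ< (suc (suc (suc k))) F ≡ Σ< (suc k) (F ∘ suc)
Σ<-drop-ends k F first last = begin
  Σ< (suc (suc k)) F + F (suc (suc k))  ≡⟨ cong₂ _+_ (Σ<-front (suc k) F) last ⟩
  F 0 + Σ< (suc k) (F ∘ suc) + + 0      ≡⟨ ℤP.+-identityʳ _ ⟩
  F 0 + Σ< (suc k) (F ∘ suc)            ≡⟨ cong (_+ Σ< (suc k) (F ∘ suc)) first ⟩
  + 0 + Σ< (suc k) (F ∘ suc)            ≡⟨ ℤP.+-identityˡ _ ⟩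
  Σ< (suc k) (F ∘ suc)                  ∎

-- Power series under the Cauchy product form a commutative monoid (up to ≗)

tail : Ser → Ser
tail f = f ∘ suc

⊛-0 : ∀ f g → (f ⊛ g) 0 ≡ f 0 * g 0
⊛-0 f g = ℤP.+-identityˡ _

⊛-suc : ∀ f g k → (f ⊛ g) (suc k) ≡ f 0 * g (suc k) + (tail f ⊛ g) k
⊛-suc f g k = Σ<-front (suc k) (λ j → f j * g (suc k ∸ j))

⊛-cong : ∀ {f f′ g g′} → f ≗ f′ → g ≗ g′ → (f ⊛ g) ≗ (f′ ⊛ g′)
⊛-cong ef eg k = Σ<-cong (suc k) (λ j _ → cong₂ _*_ (ef j) (eg (k ∸ j)))

⊛-congˡ : ∀ {f f′} g → f ≗ f′ → (f ⊛ g) ≗ (f′ ⊛ g)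
⊛-congˡ {f} {f′} g ef = ⊛-cong {f} {f′} {g} {g} ef (λ _ → refl)

⊛-congʳ : ∀ f {g g′} → g ≗ g′ → (f ⊛ g) ≗ (f ⊛ g′)
⊛-congʳ f {g} {g′} eg = ⊛-cong {f} {f} {g} {g′} (λ _ → refl) eg

⊛-linearˡ : ∀ c f f′ g → ((λ j → c * f j + f′ j) ⊛ g) ≗ (λ k → c * (f ⊛ g) k + (f′ ⊛ g) k)
⊛-linearˡ c f f′ g k = begin
  Σ< (suc k) (λ j → (c * f j + f′ j) * g (k ∸ j))
    ≡⟨ Σ<-cong (suc k) (λ j _ → distrib c (f j) (f′ j) (g (k ∸ j))) ⟩
  Σ< (suc k) (λ j → c * (f j * g (k ∸ j)) + f′ j * g (k ∸ j))
    ≡⟨ Σ<-linear (suc k) c _ _ ⟩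
  c * (f ⊛ g) k + (f′ ⊛ g) k ∎
  where
  distrib : ∀ c x x′ y → (c * x + x′) * y ≡ c * (x * y) + x′ * y
  distrib = solve-∀

⊛-identityˡ : ∀ f → (𝟙 ⊛ f) ≗ f
⊛-identityˡ f zero    = trans (⊛-0 𝟙 f) (ℤP.*-identityˡ (f 0))
⊛-identityˡ f (suc k) = begin
  (𝟙 ⊛ f) (suc k)                   ≡⟨ ⊛-suc 𝟙 f k ⟩
  + 1 * f (suc k) + (tail 𝟙 ⊛ f) k  ≡⟨ cong₂ _+_ (ℤP.*-identityˡ (f (suc k)))
                                         (Σ<-zero (suc k) (λ _ _ → refl)) ⟩
  f (suc k) + + 0                   ≡⟨ ℤP.+-identityʳ _ ⟩
  f (suc k)                         ∎

⊛-assoc : ∀ f g h → ((f ⊛ g) ⊛ h) ≗ (f ⊛ (g ⊛ h))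
⊛-assoc f g h zero = begin
  ((f ⊛ g) ⊛ h) 0    ≡⟨ ⊛-0 (f ⊛ g) h ⟩
  (f ⊛ g) 0 * h 0    ≡⟨ cong (_* h 0) (⊛-0 f g) ⟩
  f 0 * g 0 * h 0    ≡⟨ ℤP.*-assoc (f 0) _ _ ⟩
  f 0 * (g 0 * h 0)  ≡⟨ cong (f 0 *_) (sym (⊛-0 g h)) ⟩
  f 0 * (g ⊛ h) 0    ≡⟨ sym (⊛-0 f (g ⊛ h)) ⟩
  (f ⊛ (g ⊛ h)) 0    ∎
⊛-assoc f g h (suc k) = begin
  ((f ⊛ g) ⊛ h) (suc k)
    ≡⟨ ⊛-suc (f ⊛ g) h k ⟩
  (f ⊛ g) 0 * h (suc k) + (tail (f ⊛ g) ⊛ h) k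
    ≡⟨ cong₂ _+_ (cong (_* h (suc k)) (⊛-0 f g))
         (⊛-congˡ h (⊛-suc f g) k) ⟩
  f 0 * g 0 * h (suc k) + ((λ j → f 0 * tail g j + (tail f ⊛ g) j) ⊛ h) k
    ≡⟨ cong (λ z → f 0 * g 0 * h (suc k) + z)
         (trans (⊛-linearˡ (f 0) (tail g) (tail f ⊛ g) h k)
                (cong (λ z → f 0 * (tail g ⊛ h) k + z) (⊛-assoc (tail f) g h k))) ⟩
  f 0 * g 0 * h (suc k) + (f 0 * (tail g ⊛ h) k + (tail f ⊛ (g ⊛ h)) k)
    ≡⟨ regroup (f 0) (g 0) (h (suc k)) _ _ ⟩
  f 0 * (g 0 * h (suc k) + (tail g ⊛ h) k) + (tail f ⊛ (g ⊛ h)) k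
    ≡⟨ cong (λ z → f 0 * z + (tail f ⊛ (g ⊛ h)) k) (sym (⊛-suc g h k)) ⟩
  f 0 * (g ⊛ h) (suc k) + (tail f ⊛ (g ⊛ h)) k
    ≡⟨ sym (⊛-suc f (g ⊛ h) k) ⟩
  (f ⊛ (g ⊛ h)) (suc k) ∎
  where
  regroup : ∀ a b c A B → a * b * c + (a * A + B) ≡ a * (b * c + A) + B
  regroup = solve-∀

⊛-comm : ∀ f g → (f ⊛ g) ≗ (g ⊛ f)
⊛-comm f g zero = trans (⊛-0 f g) (trans (ℤP.*-comm (f 0) (g 0)) (sym (⊛-0 g f)))
⊛-comm f g (suc zero) = begin
  (f ⊛ g) 1                  ≡⟨ ⊛-suc f g 0 ⟩
  f 0 * g 1 + (tail f ⊛ g) 0 ≡⟨ cong (λ z → f 0 * g 1 + z) (⊛-0 (tail f) g) ⟩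
  f 0 * g 1 + f 1 * g 0      ≡⟨ swap (f 0) (f 1) (g 0) (g 1) ⟩
  g 0 * f 1 + g 1 * f 0      ≡⟨ cong (λ z → g 0 * f 1 + z) (sym (⊛-0 (tail g) f)) ⟩
  g 0 * f 1 + (tail g ⊛ f) 0 ≡⟨ sym (⊛-suc g f 0) ⟩
  (g ⊛ f) 1                  ∎
  where
  swap : ∀ a b c d → a * d + b * c ≡ c * b + d * a
  swap = solve-∀
⊛-comm f g (suc (suc k)) = begin
  (f ⊛ g) (2+k)
    ≡⟨ ⊛-suc f g (suc k) ⟩
  f 0 * g (2+k) + (tail f ⊛ g) (suc k)
    ≡⟨ cong (λ z → f 0 * g (2+k) + z) (trans (⊛-comm (tail f) g (suc k)) (⊛-suc g (tail f) k)) ⟩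
  f 0 * g (2+k) + (g 0 * f (2+k) + (tail g ⊛ tail f) k)
    ≡⟨ cong (λ z → f 0 * g (2+k) + (g 0 * f (2+k) + z)) (⊛-comm (tail g) (tail f) k) ⟩
  f 0 * g (2+k) + (g 0 * f (2+k) + (tail f ⊛ tail g) k)
    ≡⟨ exchange (f 0 * g (2+k)) (g 0 * f (2+k)) _ ⟩
  g 0 * f (2+k) + (f 0 * g (2+k) + (tail f ⊛ tail g) k)
    ≡⟨ cong (λ z → g 0 * f (2+k) + z) (sym (trans (⊛-comm (tail g) f (suc k)) (⊛-suc f (tail g) k))) ⟩
  g 0 * f (2+k) + (tail g ⊛ f) (suc k)
    ≡⟨ sym (⊛-suc g f (suc k)) ⟩
  (g ⊛ f) (2+k) ∎
  where
  2+k = suc (suc k)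
  exchange : ∀ a b c → a + (b + c) ≡ b + (a + c)
  exchange = solve-∀

⊛-identityʳ : ∀ f → (f ⊛ 𝟙) ≗ f
⊛-identityʳ f = ⊛-comm f 𝟙 ⟫ ⊛-identityˡ f

⊛-interchange : ∀ a b c d → ((a ⊛ b) ⊛ (c ⊛ d)) ≗ ((a ⊛ c) ⊛ (b ⊛ d))
⊛-interchange a b c d =
  ⊛-assoc a b (c ⊛ d) ⟫
  ⊛-congʳ a (≗-sym (⊛-assoc b c d) ⟫ ⊛-congˡ d (⊛-comm b c) ⟫ ⊛-assoc c b d) ⟫
  ≗-sym (⊛-assoc a c (b ⊛ d))

-- The convolution read from the other end, as it appears in the theorem.
⊛-reversed : ∀ f g k → (f ⊛ g) k ≡ Σ< (suc k) (λ j → f (k ∸ j) * g j)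
⊛-reversed f g k =
  trans (⊛-comm f g k) (Σ<-cong (suc k) (λ j _ → ℤP.*-comm (g j) (f (k ∸ j))))

pow-+ : ∀ s a c → pow s (a ℕ.+ c) ≗ (pow s a ⊛ pow s c)
pow-+ s zero    c = ≗-sym (⊛-identityˡ (pow s c))
pow-+ s (suc a) c = ⊛-congʳ s (pow-+ s a c) ⟫ ≗-sym (⊛-assoc s (pow s a) (pow s c))

Π<-cong : ∀ L {F G : ℕ → Ser} → (∀ l → F l ≗ G l) → Π< L F ≗ Π< L G
Π<-cong zero    eq = λ _ → refl
Π<-cong (suc L) eq = ⊛-cong (Π<-cong L eq) (eq L)

Π<-⊛ : ∀ L (F G : ℕ → Ser) → Π< L (λ l → F l ⊛ G l) ≗ (Π< L F ⊛ Π< L G)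
Π<-⊛ zero    F G = ≗-sym (⊛-identityˡ 𝟙)
Π<-⊛ (suc L) F G =
  ⊛-congˡ (F L ⊛ G L) (Π<-⊛ L F G) ⟫ ⊛-interchange (Π< L F) (Π< L G) (F L) (G L)

Π<-truncate : ∀ {L L′} (F : ℕ → Ser) → L ℕ.≤′ L′ →
  (∀ l → L ≤ l → F l ≗ 𝟙) → Π< L′ F ≗ Π< L F
Π<-truncate F ℕ.≤′-refl        trivial = λ _ → refl
Π<-truncate F (ℕ.≤′-step L≤L′) trivial =
  ⊛-cong (Π<-truncate F L≤L′ trivial) (trivial _ (ℕP.≤′⇒≤ L≤L′)) ⟫ ⊛-identityʳ _

Π<-vanishes-at-0 : ∀ L (F : ℕ → Ser) l → l < L → F l 0 ≡ + 0 → Π< L F 0 ≡ + 0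
Π<-vanishes-at-0 (suc L) F l l<1+L Fl0 with ℕP.m<1+n⇒m<n∨m≡n l<1+L
... | inj₁ l<L  = trans (⊛-0 (Π< L F) (F L))
                    (trans (cong (_* F L 0) (Π<-vanishes-at-0 L F l l<L Fl0)) (ℤP.*-zeroˡ (F L 0)))
... | inj₂ refl = trans (⊛-0 (Π< L F) (F L))
                    (trans (cong (Π< L F 0 *_) Fl0) (ℤP.*-zeroʳ (Π< L F 0)))

-- Substitution y ↦ y^B is a morphism of the monoid (Ser, ⊛, 𝟙)

multiple-of : ∀ B .{{_ : NonZero B}} k → k % B ≡ 0 → k ≡ (k / B) ℕ.* B
multiple-of B k eq = trans (m≡m%n+[m/n]*n k B) (cong (ℕ._+ (k / B) ℕ.* B) eq)

Σ<-multiples : ∀ B .{{_ : NonZero B}} q (H : ℕ → ℤ) → (∀ j → j % B ≢ 0 → H j ≡ + 0) →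
  Σ< (suc (q ℕ.* B)) H ≡ Σ< (suc q) (λ i → H (i ℕ.* B))
Σ<-multiples (suc B′) zero    H off = refl
Σ<-multiples (suc B′) (suc q) H off = begin
  Σ< (suc (suc q ℕ.* B)) H
    ≡⟨ cong (λ n → Σ< n H) (cong suc (ℕP.+-comm B (q ℕ.* B))) ⟩
  Σ< (suc (q ℕ.* B) ℕ.+ B) H
    ≡⟨ Σ<-split (suc (q ℕ.* B)) B H ⟩
  Σ< (suc (q ℕ.* B)) H + (Σ< B′ between + between B′)
    ≡⟨ cong₂ _+_ (Σ<-multiples B q H off)
         (cong₂ _+_ (Σ<-zero B′ (λ t t<B′ → off _ (not-multiple t t<B′)))
                    (cong H (cong suc (ℕP.+-comm (q ℕ.* B) B′)))) ⟩
  Σ< (suc q) (λ i → H (i ℕ.* B)) + (+ 0 + H (suc q ℕ.* B))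
    ≡⟨ cong (λ z → Σ< (suc q) (λ i → H (i ℕ.* B)) + z) (ℤP.+-identityˡ _) ⟩
  Σ< (suc (suc q)) (λ i → H (i ℕ.* B)) ∎
  where
  B = suc B′
  between : ℕ → ℤ
  between t = H (suc (q ℕ.* B) ℕ.+ t)
  not-multiple : ∀ t → t < B′ → (suc (q ℕ.* B) ℕ.+ t) % B ≢ 0
  not-multiple t t<B′ eq = ℕP.0≢1+n (begin
    0                              ≡⟨ sym eq ⟩
    (suc (q ℕ.* B) ℕ.+ t) % B      ≡⟨ cong (_% B) (cong suc (ℕP.+-comm (q ℕ.* B) t)) ⟩
    (suc t ℕ.+ q ℕ.* B) % B        ≡⟨ [m+kn]%n≡m%n (suc t) q B ⟩
    suc t % B                      ≡⟨ m<n⇒m%n≡m (s≤s t<B′) ⟩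
    suc t                          ∎)

module _ (B : ℕ) .{{_ : NonZero B}} where

  substPow-on : ∀ s k → k % B ≡ 0 → substPow B s k ≡ s (k / B)
  substPow-on s k eq rewrite eq = refl

  substPow-off : ∀ s k → k % B ≢ 0 → substPow B s k ≡ + 0
  substPow-off s k ne with k % B
  ... | zero  = contradiction refl ne
  ... | suc _ = refl

  substPow-multiple : ∀ s i → substPow B s (i ℕ.* B) ≡ s i
  substPow-multiple s i = trans (substPow-on s (i ℕ.* B) (m*n%n≡0 i B)) (cong s (m*n/n≡m i B))

  substPow-cong : ∀ {s t} → s ≗ t → substPow B s ≗ substPow B t
  substPow-cong eq k with (k % B) ℕ.≡ᵇ 0
  ... | true  = eq (k / B)
  ... | false = refl

  substPow-𝟙 : substPow B 𝟙 ≗ 𝟙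
  substPow-𝟙 zero = substPow-multiple 𝟙 0
  substPow-𝟙 (suc k) with suc k % B ℕ.≟ 0
  ... | no ne  = substPow-off 𝟙 (suc k) ne
  ... | yes eq = trans (substPow-on 𝟙 (suc k) eq) (positive-quotient (suc k / B) refl)
    where
    positive-quotient : ∀ q → suc k / B ≡ q → 𝟙 q ≡ + 0
    positive-quotient zero    e = contradiction (trans (multiple-of B (suc k) eq) (cong (ℕ._* B) e))
                                    ℕP.1+n≢0
    positive-quotient (suc q) e = refl

  substPow-⊛-multiple : ∀ f g q → (substPow B f ⊛ substPow B g) (q ℕ.* B) ≡ (f ⊛ g) q
  substPow-⊛-multiple f g q =
    trans (Σ<-multiples B q _ off) (Σ<-cong (suc q) on)
    where
    off : ∀ j → j % B ≢ 0 → substPow B f j * substPow B g (q ℕ.* B ∸ j) ≡ + 0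
    off j ne = trans (cong (_* substPow B g (q ℕ.* B ∸ j)) (substPow-off f j ne)) (ℤP.*-zeroˡ (substPow B g (q ℕ.* B ∸ j)))
    on : ∀ i → i < suc q →
      substPow B f (i ℕ.* B) * substPow B g (q ℕ.* B ∸ i ℕ.* B) ≡ f i * g (q ∸ i)
    on i _ = cong₂ _*_ (substPow-multiple f i)
      (trans (cong (substPow B g) (sym (ℕP.*-distribʳ-∸ B q i))) (substPow-multiple g (q ∸ i)))

  -- If B ∤ k then in every split k = j + (k - j) one part is not a multiple of B.
  substPow-⊛ : ∀ f g → substPow B (f ⊛ g) ≗ (substPow B f ⊛ substPow B g)
  substPow-⊛ f g k with k % B ℕ.≟ 0
  ... | yes eq = begin
    substPow B (f ⊛ g) k                      ≡⟨ substPow-on (f ⊛ g) k eq ⟩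
    (f ⊛ g) (k / B)                           ≡⟨ sym (substPow-⊛-multiple f g (k / B)) ⟩
    (substPow B f ⊛ substPow B g) (k / B ℕ.* B) ≡⟨ cong (substPow B f ⊛ substPow B g) (sym (multiple-of B k eq)) ⟩
    (substPow B f ⊛ substPow B g) k           ∎
  ... | no ne = trans (substPow-off (f ⊛ g) k ne) (sym (Σ<-zero (suc k) vanish))
    where
    vanish : ∀ j → j < suc k → substPow B f j * substPow B g (k ∸ j) ≡ + 0
    vanish j j≤k with j % B ℕ.≟ 0
    ... | no  j-off = trans (cong (_* substPow B g (k ∸ j)) (substPow-off f j j-off)) (ℤP.*-zeroˡ (substPow B g (k ∸ j)))
    ... | yes j-on  = trans (cong (substPow B f j *_) (substPow-off g (k ∸ j) rest-off)) (ℤP.*-zeroʳ (substPow B f j))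
      where
      rest-off : (k ∸ j) % B ≢ 0
      rest-off rest-on = ne (begin
        k % B                             ≡⟨ cong (_% B) (sym (ℕP.m+[n∸m]≡n (ℕP.≤-pred j≤k))) ⟩
        (j ℕ.+ (k ∸ j)) % B               ≡⟨ %-distribˡ-+ j (k ∸ j) B ⟩
        (j % B ℕ.+ (k ∸ j) % B) % B       ≡⟨ cong₂ (λ a c → (a ℕ.+ c) % B) j-on rest-on ⟩
        0 % B                             ≡⟨ m*n%n≡0 0 B ⟩
        0                                 ∎)

shift-cong : ∀ S {f g} → f ≗ g → shift S f ≗ shift S g
shift-cong S eq k with S ℕ.≤ᵇ k
... | true  = eq _
... | false = refl

shift-zero : ∀ f → shift 0 f ≗ f
shift-zero f k = refl

shift-suc : ∀ a f → shift (suc a) f ≗ shift 1 (shift a f)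
shift-suc a       f zero    = refl
shift-suc zero    f (suc k) = refl
shift-suc (suc a) f (suc k) = refl

shift-+ : ∀ a c f → shift (a ℕ.+ c) f ≗ shift a (shift c f)
shift-+ zero    c f k = refl
shift-+ (suc a) c f   = shift-suc (a ℕ.+ c) f ⟫ shift-cong 1 (shift-+ a c f) ⟫ ≗-sym (shift-suc a (shift c f))

shift-⊛ˡ : ∀ a f g → (shift a f ⊛ g) ≗ shift a (f ⊛ g)
shift-⊛ˡ zero    f g = ⊛-congˡ g (shift-zero f)
shift-⊛ˡ (suc a) f g =
  ⊛-congˡ g (shift-suc a f) ⟫ shift1-⊛ (shift a f) ⟫
  shift-cong 1 (shift-⊛ˡ a f g) ⟫ ≗-sym (shift-suc a (f ⊛ g))
  where
  shift1-⊛ : ∀ h → (shift 1 h ⊛ g) ≗ shift 1 (h ⊛ g)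
  shift1-⊛ h zero    = ⊛-0 (shift 1 h) g
  shift1-⊛ h (suc k) = trans (⊛-suc (shift 1 h) g k) (ℤP.+-identityˡ _)

shift-⊛ : ∀ a c f g → shift (a ℕ.+ c) (f ⊛ g) ≗ (shift a f ⊛ shift c g)
shift-⊛ a c f g =
  shift-+ a c (f ⊛ g) ⟫
  shift-cong a (shift-cong c (⊛-comm f g) ⟫ ≗-sym (shift-⊛ˡ c g f) ⟫ ⊛-comm (shift c g) f) ⟫
  ≗-sym (shift-⊛ˡ a f (shift c g))

shift-at-0 : ∀ S f → 0 < S → shift S f 0 ≡ + 0
shift-at-0 (suc S) f _ = refl

-- Base-b digits

-- b - 1 < b for b > 0, to read the carry-free condition as digit sum < b.
n∸1<n : ∀ n → 0 < n → n ∸ 1 < n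
n∸1<n (suc n) _ = ℕP.n<1+n n

module Digits (b : ℕ) .{{_ : NonZero b}} where

  quotient : ℕ → ℕ → ℕ
  quotient l r = _/_ r (b ℕ.^ l) {{ℕP.m^n≢0 b l}}

  quotient-suc : ∀ l r → quotient (suc l) r ≡ quotient l r / b
  quotient-suc l r = sym (trans (m/n/o≡m/[n*o] r (b ℕ.^ l) b {{ℕP.m^n≢0 b l}} {{_}} {{b^l*b≢0}})
                                (/-congʳ {{b^l*b≢0}} {{ℕP.m^n≢0 b (suc l)}} (ℕP.*-comm (b ℕ.^ l) b)))
    where
    b^l*b≢0 : NonZero (b ℕ.^ l ℕ.* b)
    b^l*b≢0 = ℕP.m*n≢0 (b ℕ.^ l) b {{ℕP.m^n≢0 b l}}

  quotient-digit : ∀ l r → quotient l r ≡ digit b l r ℕ.+ quotient (suc l) r ℕ.* b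
  quotient-digit l r = trans (m≡m%n+[m/n]*n (quotient l r) b)
    (cong (λ q → digit b l r ℕ.+ q ℕ.* b) (sym (quotient-suc l r)))

  -- b^l > l, so a number r has no digits at positions l > r.
  l<b^l : 2 ≤ b → ∀ l → l < b ℕ.^ l
  l<b^l b≥2 zero    = s≤s z≤n
  l<b^l b≥2 (suc l) = ℕP.≤-<-trans (l<b^l b≥2 l)
    (ℕP.<-≤-trans (ℕP.m<m+n (b ℕ.^ l) (ℕP.≤-trans (ℕP.m^n>0 b l) (ℕP.m≤m+n (b ℕ.^ l) 0)))
                  (ℕP.*-monoˡ-≤ (b ℕ.^ l) b≥2))

  digit-beyond : 2 ≤ b → ∀ {r l} → r < l → digit b l r ≡ 0
  digit-beyond b≥2 {r} {l} r<l =
    trans (cong (_% b) (m<n⇒m/n≡0 {{ℕP.m^n≢0 b l}} (ℕP.<-trans r<l (l<b^l b≥2 l)))) (m*n%n≡0 0 b)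

  digits-below : ∀ {r} l → (∀ j → j < l → digit b j r ≡ 0) → r ≡ quotient l r ℕ.* b ℕ.^ l
  digits-below {r} zero    vanish = sym (trans (ℕP.*-identityʳ _) (n/1≡n r))
  digits-below {r} (suc l) vanish = begin
    r                                         ≡⟨ digits-below l (λ j j<l → vanish j (ℕP.m<n⇒m<1+n j<l)) ⟩
    quotient l r ℕ.* b ℕ.^ l                  ≡⟨ cong (ℕ._* b ℕ.^ l) (trans (quotient-digit l r)
                                                   (cong (ℕ._+ quotient (suc l) r ℕ.* b) (vanish l ℕP.≤-refl))) ⟩
    quotient (suc l) r ℕ.* b ℕ.* b ℕ.^ l      ≡⟨ ℕP.*-assoc (quotient (suc l) r) b (b ℕ.^ l) ⟩
    quotient (suc l) r ℕ.* b ℕ.^ suc l        ∎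

  zero-digits⇒zero : 2 ≤ b → ∀ {r} → (∀ l → l < suc r → digit b l r ≡ 0) → r ≡ 0
  zero-digits⇒zero b≥2 {r} vanish = trans (digits-below (suc r) vanish)
    (cong (ℕ._* b ℕ.^ suc r) (m<n⇒m/n≡0 {{ℕP.m^n≢0 b (suc r)}} (ℕP.<-trans (ℕP.n<1+n r) (l<b^l b≥2 (suc r)))))

  nonzero-digit : 2 ≤ b → ∀ {r} → 1 ≤ r → ∃[ l ] l < suc r × digit b l r ≢ 0
  nonzero-digit b≥2 {r} r≥1 =
    let (i , digit≢0) = ¬∀⟶∃¬ (suc r) (λ i → digit b (toℕ i) r ≡ 0)
                                (λ i → digit b (toℕ i) r ℕ.≟ 0) not-all-zero
    in toℕ i , toℕ<n i , digit≢0
    where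
    not-all-zero : ¬ (∀ i → digit b (toℕ i) r ≡ 0)
    not-all-zero all-zero = ℕP.<⇒≢ r≥1 (sym (zero-digits⇒zero b≥2 (λ l l<1+r →
      subst (λ x → digit b x r ≡ 0) (toℕ-fromℕ< l<1+r) (all-zero (fromℕ< l<1+r)))))

  CarryFree : ℕ → ℕ → Set
  CarryFree n m = ∀ l → digit b l n ℕ.+ digit b l m ≤ b ∸ 1

  module _ {n m} (carry-free : CarryFree n m) where

    digit-sum<b : ∀ l → digit b l n ℕ.+ digit b l m < b
    digit-sum<b l = ℕP.≤-<-trans (carry-free l) (n∸1<n b (ℕ.>-nonZero⁻¹ b))

    quotient-+ : ∀ l → quotient l (n ℕ.+ m) ≡ quotient l n ℕ.+ quotient l m
    quotient-+ zero = trans (n/1≡n _) (sym (cong₂ ℕ._+_ (n/1≡n n) (n/1≡n m)))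
    quotient-+ (suc l) = begin
      quotient (suc l) (n ℕ.+ m)               ≡⟨ quotient-suc l (n ℕ.+ m) ⟩
      quotient l (n ℕ.+ m) / b                 ≡⟨ /-congˡ (quotient-+ l) ⟩
      (quotient l n ℕ.+ quotient l m) / b      ≡⟨ +-distrib-/ (quotient l n) (quotient l m) (digit-sum<b l) ⟩
      quotient l n / b ℕ.+ quotient l m / b    ≡⟨ sym (cong₂ ℕ._+_ (quotient-suc l n) (quotient-suc l m)) ⟩
      quotient (suc l) n ℕ.+ quotient (suc l) m ∎

    digit-+ : ∀ l → digit b l (n ℕ.+ m) ≡ digit b l n ℕ.+ digit b l m
    digit-+ l = begin
      quotient l (n ℕ.+ m) % b                 ≡⟨ cong (_% b) (quotient-+ l) ⟩
      (quotient l n ℕ.+ quotient l m) % b      ≡⟨ %-distribˡ-+ (quotient l n) (quotient l m) b ⟩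
      (digit b l n ℕ.+ digit b l m) % b        ≡⟨ m<n⇒m%n≡m (digit-sum<b l) ⟩
      digit b l n ℕ.+ digit b l m              ∎

  module DigitProduct (Φ : ℕ → ℕ → Ser)
                      (Φ-+ : ∀ d e l → Φ (d ℕ.+ e) l ≗ (Φ d l ⊛ Φ e l))
                      (Φ-0 : ∀ l → Φ 0 l ≗ 𝟙) where

    factor : ℕ → ℕ → Ser
    factor r l = Φ (digit b l r) l

    digitProduct : ℕ → Ser
    digitProduct r = Π< (suc r) (factor r)

    factor-beyond : 2 ≤ b → ∀ r l → suc r ≤ l → factor r l ≗ 𝟙
    factor-beyond b≥2 r l r<l k = trans (cong (λ d → Φ d l k) (digit-beyond b≥2 r<l)) (Φ-0 l k)

    digitProduct-+ : 2 ≤ b → ∀ {n m} → CarryFree n m →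
      digitProduct (n ℕ.+ m) ≗ (digitProduct n ⊛ digitProduct m)
    digitProduct-+ b≥2 {n} {m} carry-free =
      Π<-cong (suc (n ℕ.+ m)) factor-+ ⟫
      Π<-⊛ (suc (n ℕ.+ m)) (factor n) (factor m) ⟫
      ⊛-cong (Π<-truncate (factor n) (ℕP.≤⇒≤′ (s≤s (ℕP.m≤m+n n m))) (factor-beyond b≥2 n))
             (Π<-truncate (factor m) (ℕP.≤⇒≤′ (s≤s (ℕP.m≤n+m m n))) (factor-beyond b≥2 m))
      where
      factor-+ : ∀ l → factor (n ℕ.+ m) l ≗ (factor n l ⊛ factor m l)
      factor-+ l k = trans (cong (λ d → Φ d l k) (digit-+ carry-free l)) (Φ-+ _ _ l k)

  negXFactor : ℕ → ℕ → Ser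
  negXFactor d l = substPow (b ℕ.^ l) {{ℕP.m^n≢0 b l}} (pow invOnePlusY d)

  negYFactor : ℕ → ℕ → Ser
  negYFactor d l = shift (d ℕ.* b ℕ.^ l) (negXFactor d l)

  negXFactor-+ : ∀ d e l → negXFactor (d ℕ.+ e) l ≗ (negXFactor d l ⊛ negXFactor e l)
  negXFactor-+ d e l =
    substPow-cong (b ℕ.^ l) {{ℕP.m^n≢0 b l}} (pow-+ invOnePlusY d e) ⟫
    substPow-⊛ (b ℕ.^ l) {{ℕP.m^n≢0 b l}} (pow invOnePlusY d) (pow invOnePlusY e)

  negXFactor-0 : ∀ l → negXFactor 0 l ≗ 𝟙
  negXFactor-0 l = substPow-𝟙 (b ℕ.^ l) {{ℕP.m^n≢0 b l}}

  negYFactor-+ : ∀ d e l → negYFactor (d ℕ.+ e) l ≗ (negYFactor d l ⊛ negYFactor e l)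
  negYFactor-+ d e l =
    (λ k → cong (λ S → shift S (negXFactor (d ℕ.+ e) l) k) (ℕP.*-distribʳ-+ (b ℕ.^ l) d e)) ⟫
    shift-cong (d ℕ.* b ℕ.^ l ℕ.+ e ℕ.* b ℕ.^ l) (negXFactor-+ d e l) ⟫
    shift-⊛ (d ℕ.* b ℕ.^ l) (e ℕ.* b ℕ.^ l) (negXFactor d l) (negXFactor e l)

  negYFactor-0 : ∀ l → negYFactor 0 l ≗ 𝟙
  negYFactor-0 = negXFactor-0

  negYFactor-at-0 : ∀ d l → d ≢ 0 → negYFactor d l 0 ≡ + 0
  negYFactor-at-0 d l d≢0 = shift-at-0 (d ℕ.* b ℕ.^ l) (negXFactor d l)
    (ℕ.>-nonZero⁻¹ (d ℕ.* b ℕ.^ l) {{ℕP.m*n≢0 d (b ℕ.^ l) {{ℕ.≢-nonZero d≢0}} {{ℕP.m^n≢0 b l}}}})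

  module NegX = DigitProduct negXFactor negXFactor-+ negXFactor-0
  module NegY = DigitProduct negYFactor negYFactor-+ negYFactor-0

  fNegY-at-0 : 2 ≤ b → ∀ {r} → 1 ≤ r → fNegY b r 0 ≡ + 0
  fNegY-at-0 b≥2 {r} r≥1 =
    let (l , l≤r , digit≢0) = nonzero-digit b≥2 r≥1
    in Π<-vanishes-at-0 (suc r) (NegY.factor r) l l≤r (negYFactor-at-0 _ l digit≢0)

-- Convolution identities for carry-free n + m

module _ (b : ℕ) .{{_ : NonZero b}} (b≥2 : 2 ≤ b) {n m : ℕ}
         (carry-free : Digits.CarryFree b n m) where
  open Digits b

  negX-convolution : ∀ k →
    fNegX b (n ℕ.+ m) k ≡ Σ< (suc k) (λ j → fNegX b n (k ∸ j) * fNegX b m j)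
  negX-convolution k =
    trans (NegX.digitProduct-+ b≥2 carry-free k) (⊛-reversed (fNegX b n) (fNegX b m) k)

  -- The coefficient of y^{k+2}; the end terms drop out since both factors
  -- are divisible by y.
  negY-convolution : 1 ≤ n → 1 ≤ m → ∀ k →
    fNegY b (n ℕ.+ m) (suc (suc k)) ≡ Σ< (suc k) (λ i → fNegY b n (suc (k ∸ i)) * fNegY b m (suc i))
  negY-convolution n≥1 m≥1 k = begin
    fNegY b (n ℕ.+ m) 2+k                        ≡⟨ NegY.digitProduct-+ b≥2 carry-free 2+k ⟩
    (Yn ⊛ Ym) 2+k                                ≡⟨ ⊛-reversed Yn Ym 2+k ⟩
    Σ< (suc 2+k) (λ j → Yn (2+k ∸ j) * Ym j)      ≡⟨ Σ<-drop-ends k (λ j → Yn (2+k ∸ j) * Ym j) first last ⟩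
    Σ< (suc k) (λ i → Yn (suc k ∸ i) * Ym (suc i)) ≡⟨ Σ<-cong (suc k) (λ i i<1+k →
                                                       cong (λ z → Yn z * Ym (suc i)) (ℕP.+-∸-assoc 1 (ℕP.≤-pred i<1+k))) ⟩
    Σ< (suc k) (λ i → Yn (suc (k ∸ i)) * Ym (suc i)) ∎
    where
    2+k = suc (suc k)
    Yn = fNegY b n
    Ym = fNegY b m
    first : Yn 2+k * Ym 0 ≡ + 0
    first = trans (cong (Yn 2+k *_) (fNegY-at-0 b≥2 m≥1)) (ℤP.*-zeroʳ (Yn 2+k))
    last : Yn (2+k ∸ 2+k) * Ym 2+k ≡ + 0
    last = trans (cong (λ j → Yn j * Ym 2+k) (ℕP.n∸n≡0 2+k))
                 (trans (cong (_* Ym 2+k) (fNegY-at-0 b≥2 n≥1)) (ℤP.*-zeroˡ (Ym 2+k)))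

negative-index : ∀ k i → i ≤ k → ℤ.- (+ suc (suc k)) + + suc i ≡ -[1+ k ∸ i ]
negative-index k i i≤k =
  trans (ℤP.⊖-≤ (s≤s (ℕP.m≤n⇒m≤1+n i≤k))) (cong (λ z → ℤ.- (+ z)) (ℕP.+-∸-assoc 1 i≤k))

-- Proposition 3.3: both identities are the coefficient identities above,
-- after unfolding the b-ary binomial coefficients of negative arguments
-- (the first one in fact holds for every k ≥ 0).
proposition3p3 : (b : ℕ) .{{_ : NonZero b}} → 2 ≤ b →
    (n m : ℕ) → 1 ≤ n → 1 ≤ m →
    (∀ l → digit b l n ℕ.+ digit b l m ≤ b ∸ 1) →
    ((k : ℕ) → m ≤ k →
      binom b (ℤ.- (+ n) ℤ.- (+ m)) (+ k)
        ≡ Σ[ 0 to k ] (λ j → binom b (ℤ.- (+ n)) (+ (k ∸ j)) ℤ.* binom b (ℤ.- (+ m)) (+ j)))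
    × ((k : ℕ) → n ℕ.+ m ≤ k →
      binom b (ℤ.- (+ n) ℤ.- (+ m)) (ℤ.- (+ k))
        ≡ Σ[ 1 to k ∸ 1 ] (λ j → binom b (ℤ.- (+ n)) (ℤ.- (+ k) ℤ.+ (+ j)) ℤ.* binom b (ℤ.- (+ m)) (ℤ.- (+ j))))
proposition3p3 b b≥2 zero    m       () _  _
proposition3p3 b b≥2 (suc n) zero    _  () _
proposition3p3 b b≥2 (suc n) (suc m) n≥1 m≥1 carry-free =
  (λ k _ → trans (cong (λ r → fNegX b r k) argument-sum) (negX-convolution b b≥2 carry-free k)) ,
  λ { zero          ()
    ; (suc zero)    (s≤s n+m≤0) → contradiction (ℕP.m+n≤o⇒n≤o n n+m≤0) λ ()
    ; (suc (suc k)) _ →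
        trans (cong (λ r → fNegY b r (suc (suc k))) argument-sum)
          (trans (negY-convolution b b≥2 carry-free n≥1 m≥1 k)
            (Σ<-cong (suc k) (λ i i<1+k → cong (λ z → binom b -[1+ n ] z * fNegY b (suc m) (suc i))
              (sym (negative-index k i (ℕP.≤-pred i<1+k)))))) }
  where
  argument-sum : suc (suc (n ℕ.+ m)) ≡ suc n ℕ.+ suc m
  argument-sum = cong suc (sym (ℕP.+-suc n m))
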